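{- Let $A$ and $B$ be bounded lattices and $h:A\to B$ a surjective lattice homomorphism. Then $h^\delta:A^\delta\to B^\delta$ is an open map when both $A^\delta$ and $B^\delta$ carry the $\delta$-topology.
   Context: A canonical extension of a bounded lattice $L$ is a complete lattice $L^\delta$ with a lattice embedding $L\hookrightarrow L^\delta$ (identify $L$ with its image) satisfying Density (every element is a join of meets and a meet of joins of elements of $L$) and Compactness (if $\bigwedge S\le\bigvee T$ in $L^\delta$ for $S,T\subseteq L$, then $\bigwedge S'\le\bigvee T'$ for some finite $S'\subseteq S,T'\subseteq T$). Filter elements are meets of subsets of $L$, ideal elements are joins of subsets of $L$. The $\delta$-topology on $L^\delta$ has as basis the intervals $[x,y]={\uparrow}x\cap{\downarrow}y$ with $x$ a filter element and $y$ an ideal element. For a lattice homomorphism $h:A\to B$, $h^\delta:A^\delta\to B^\delta$ is defined by $h^\delta(u)=\bigvee\{\bigwedge h([x,y]\cap A)\mid x\le u\le y,\ x$ filter element, $y$ ideal element$\}$ (computed in $B^\delta$); it extends $h$. -}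

module Defs where

open import Level using (Level; _⊔_; suc; Setω)
open import Data.Product using (Σ; ∃; ∃-syntax; _×_; _,_)
open import Data.Sum using (_⊎_)
open import Data.List using (List)
open import Data.List.Relation.Unary.All using (All)
open import Data.List.Membership.Propositional using (_∈_)
open import Relation.Unary using (Pred; _⊆_)
open import Relation.Binary using (Rel; IsPartialOrder)
open import Relation.Binary.PropositionalEquality using (_≡_)
open import Relation.Binary.Lattice.Bundles using (BoundedLattice)

record CompleteLattice (ℓ : Level) : Setω where
  infix 4 _≈_ _≤_
  field
    Carrier        : Set ℓ
    _≈_            : Rel Carrier ℓ
    _≤_            : Rel Carrier ℓ
    isPartialOrder : IsPartialOrder _≈_ _≤_
    ⋁              : ∀ {p} → Pred Carrier p → Carrier
    ⋀              : ∀ {p} → Pred Carrier p → Carrier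
    ⋁-upper        : ∀ {p} (P : Pred Carrier p) {x} → P x → x ≤ ⋁ P
    ⋁-least        : ∀ {p} (P : Pred Carrier p) {z} → (∀ {x} → P x → x ≤ z) → ⋁ P ≤ z
    ⋀-lower        : ∀ {p} (P : Pred Carrier p) {x} → P x → ⋀ P ≤ x
    ⋀-greatest     : ∀ {p} (P : Pred Carrier p) {z} → (∀ {x} → P x → z ≤ x) → z ≤ ⋀ P

  _⊔ᶜ_ : Carrier → Carrier → Carrier
  x ⊔ᶜ y = ⋁ (λ z → z ≡ x ⊎ z ≡ y)

  _⊓ᶜ_ : Carrier → Carrier → Carrier
  x ⊓ᶜ y = ⋀ (λ z → z ≡ x ⊎ z ≡ y)

  ⊤ᶜ : Carrier
  ⊤ᶜ = ⋀ {Level.zero} (λ _ → Data.Empty.⊥)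
    where import Data.Empty

  ⊥ᶜ : Carrier
  ⊥ᶜ = ⋁ {Level.zero} (λ _ → Data.Empty.⊥)
    where import Data.Empty

record IsLatticeHom {ℓ} (A B : BoundedLattice ℓ ℓ ℓ)
  (h : BoundedLattice.Carrier A → BoundedLattice.Carrier B) : Set ℓ where
  private
    module A = BoundedLattice A
    module B = BoundedLattice B
  field
    cong   : ∀ {a b} → a A.≈ b → h a B.≈ h b
    hom-∨  : ∀ a b → h (a A.∨ b) B.≈ (h a B.∨ h b)
    hom-∧  : ∀ a b → h (a A.∧ b) B.≈ (h a B.∧ h b)

Surjective : ∀ {ℓ} (A B : BoundedLattice ℓ ℓ ℓ) →
  (BoundedLattice.Carrier A → BoundedLattice.Carrier B) → Set ℓ
Surjective A B h = ∀ b → ∃[ a ] (h a B.≈ b)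
  where module B = BoundedLattice B

module _ {ℓ} (L : BoundedLattice ℓ ℓ ℓ) (D : CompleteLattice ℓ)
         (e : BoundedLattice.Carrier L → CompleteLattice.Carrier D) where
  private
    module L = BoundedLattice L
    module D = CompleteLattice D

  img : ∀ {p} → Pred L.Carrier p → Pred D.Carrier (ℓ ⊔ p)
  img S u = ∃[ a ] (S a × e a D.≈ u)

  IsFilterElt : D.Carrier → Set (suc ℓ)
  IsFilterElt u = ∃[ S ] (u D.≈ D.⋀ (img {ℓ} S))

  IsIdealElt : D.Carrier → Set (suc ℓ)
  IsIdealElt u = ∃[ S ] (u D.≈ D.⋁ (img {ℓ} S))

  listSet : List L.Carrier → Pred L.Carrier ℓ
  listSet xs a = a ∈ xs

  record IsCanonicalExtension : Set (suc (suc ℓ)) where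
    field
      e-cong  : ∀ {a b} → a L.≈ b → e a D.≈ e b
      e-inj   : ∀ {a b} → e a D.≈ e b → a L.≈ b
      e-∨     : ∀ a b → e (a L.∨ b) D.≈ (e a D.⊔ᶜ e b)
      e-∧     : ∀ a b → e (a L.∧ b) D.≈ (e a D.⊓ᶜ e b)
      e-⊤     : e L.⊤ D.≈ D.⊤ᶜ
      e-⊥     : e L.⊥ D.≈ D.⊥ᶜ
      dense-∨⋀ : ∀ u → ∃[ P ] ((∀ {v} → P v → IsFilterElt v) × u D.≈ D.⋁ {suc ℓ} P)
      dense-⋀∨ : ∀ u → ∃[ P ] ((∀ {v} → P v → IsIdealElt v) × u D.≈ D.⋀ {suc ℓ} P)
      compact  : (S T : Pred L.Carrier ℓ) →
                 D.⋀ (img S) D.≤ D.⋁ (img T) →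
                 ∃[ S′ ] ∃[ T′ ] (All S S′ × All T T′ ×
                   D.⋀ (img (listSet S′)) D.≤ D.⋁ (img (listSet T′)))

  -- δ-topology: U is open iff it is a union of basic intervals [x,y]
  -- (x a filter element, y an ideal element), i.e. every point of U
  -- lies in some basic interval contained in U.
  IsδOpen : ∀ {p} → Pred D.Carrier p → Set (suc ℓ ⊔ p)
  IsδOpen U = ∀ u → U u →
    ∃[ x ] ∃[ y ] (IsFilterElt x × IsIdealElt y × x D.≤ u × u D.≤ y ×
      (∀ w → x D.≤ w → w D.≤ y → U w))

module _ {ℓ} (A B : BoundedLattice ℓ ℓ ℓ) (Aδ Bδ : CompleteLattice ℓ)
         (eA : BoundedLattice.Carrier A → CompleteLattice.Carrier Aδ)
         (eB : BoundedLattice.Carrier B → CompleteLattice.Carrier Bδ)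
         (h : BoundedLattice.Carrier A → BoundedLattice.Carrier B) where
  private
    module A = BoundedLattice A
    module Aδ = CompleteLattice Aδ
    module Bδ = CompleteLattice Bδ

  hδ : Aδ.Carrier → Bδ.Carrier
  hδ u = Bδ.⋁ (λ w → ∃[ x ] ∃[ y ]
            (IsFilterElt A Aδ eA x × IsIdealElt A Aδ eA y ×
             x Aδ.≤ u × u Aδ.≤ y ×
             w Bδ.≈ Bδ.⋀ (img B Bδ eB (λ b → ∃[ a ]
                        (x Aδ.≤ eA a × eA a Aδ.≤ y × h a ≡ b)))))

module _ {ℓ} (C D : CompleteLattice ℓ) where
  private
    module D = CompleteLattice D
  image : ∀ {p} (f : CompleteLattice.Carrier C → D.Carrier) →
          Pred (CompleteLattice.Carrier C) p → Pred D.Carrier (ℓ ⊔ p)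
  image f U v = ∃[ u ] (U u × f u D.≈ v)

module Submission where

-- Everything rests on a directed form of compactness: if S ⊆ L is
-- down-directed, T ⊆ L is up-directed and ⋀S ≤ ⋁T in L^δ, then s ≤ t for
-- some s ∈ S, t ∈ T.  Since a filter element x is the meet of the
-- (down-directed) set ↑x of lattice elements above it, and dually for ideal
-- elements, this yields interpolation (filter ≤ ideal ⇒ some a ∈ L lies
-- between them) and its one-sided variants.
--
-- For h : A → B write hσ(x) = ⋀ h[↑x] and hπ(y) = ⋁ h[↓y].  Given a basic
-- interval [x,y] ⊆ U around u, the basic interval [hσ x, hπ y] contains
-- h^δ(u), and every w in it equals h^δ(u') for
--     u' = ⋁ { q filter | x ≤ q ≤ y, hσ q ≤ w } ∈ [x,y] ⊆ U.
-- By density, h^δ(u') ≤ w is tested against ideal elements z ≥ w (via the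
-- "pullback" ⋁ {a | h a ≤ z}), and w ≤ h^δ(u') against filter elements
-- p ≤ w (via the "lift" ⋀ {a | x ≤ a, p ≤ h a}); surjectivity of h is used
-- to realise elements of B below an ideal element, and for h ⊤ = ⊤, h ⊥ = ⊥.

open import Defs
open import Level using (Level; _⊔_)
open import Function using (flip)
open import Relation.Unary using (Pred)
open import Relation.Binary using (Rel; Transitive)
open import Relation.Binary.Structures using (IsPartialOrder)
open import Relation.Binary.Lattice.Bundles using (BoundedLattice)
open import Relation.Binary.PropositionalEquality using (_≡_; refl)
open import Data.Product using (∃-syntax; _×_; _,_)
open import Data.Sum using (inj₁; inj₂)
open import Data.List.Relation.Unary.All as All using (All; []; _∷_)

Directed : ∀ {a r s} {X : Set a} → Rel X r → Pred X s → Set (a ⊔ r ⊔ s)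
Directed R S = (∃[ x ] S x) × (∀ {x y} → S x → S y → ∃[ z ] (S z × R z x × R z y))

finite-bound : ∀ {a r s} {X : Set a} {R : Rel X r} {S : Pred X s} →
  Transitive R → Directed R S → ∀ {xs} → All S xs → ∃[ z ] (S z × All (R z) xs)
finite-bound tr ((z , Sz) , _) [] = z , Sz , []
finite-bound tr d@(_ , common) (Sx ∷ Sxs) with finite-bound tr d Sxs
... | z , Sz , z-bounds with common Sx Sz
... | z′ , Sz′ , z′x , z′z = z′ , Sz′ , z′x ∷ All.map (tr z′z) z-bounds

_[_] : ∀ {a b s} {X : Set a} {Y : Set b} → (X → Y) → Pred X s → Pred Y (a ⊔ b ⊔ s)
(f [ S ]) y = ∃[ x ] (S x × f x ≡ y)

image-directed : ∀ {a b r r′ s} {X : Set a} {Y : Set b} {R : Rel X r} {R′ : Rel Y r′}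
  {S : Pred X s} (f : X → Y) → (∀ {x y} → R x y → R′ (f x) (f y)) →
  Directed R S → Directed R′ (f [ S ])
image-directed f mono ((x , Sx) , common) =
  (f x , x , Sx , refl) ,
  λ { (x , Sx , refl) (y , Sy , refl) →
        let (z , Sz , zx , zy) = common Sx Sy in f z , (z , Sz , refl) , mono zx , mono zy }

module _ {ℓ} (L : BoundedLattice ℓ ℓ ℓ) where
  open BoundedLattice L

  meet-closed-directed : ∀ {s} {S : Pred Carrier s} →
    S ⊤ → (∀ {x y} → S x → S y → S (x ∧ y)) → Directed _≤_ S
  meet-closed-directed S⊤ S∧ = (⊤ , S⊤) , λ Sx Sy → _ , S∧ Sx Sy , x∧y≤x _ _ , x∧y≤y _ _

  join-closed-directed : ∀ {s} {S : Pred Carrier s} →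
    S ⊥ → (∀ {x y} → S x → S y → S (x ∨ y)) → Directed (flip _≤_) S
  join-closed-directed S⊥ S∨ = (⊥ , S⊥) , λ Sx Sy → _ , S∨ Sx Sy , x≤x∨y _ _ , y≤x∨y _ _

module CompleteLatticeFacts {ℓ} (D : CompleteLattice ℓ) where
  open CompleteLattice D
  open IsPartialOrder isPartialOrder public
    using (reflexive; trans; antisym; module Eq) renaming (refl to ≤-refl)

  ≤-⊤ᶜ : ∀ x → x ≤ ⊤ᶜ
  ≤-⊤ᶜ x = ⋀-greatest _ (λ ())

  ⊥ᶜ-≤ : ∀ x → ⊥ᶜ ≤ x
  ⊥ᶜ-≤ x = ⋁-least _ (λ ())

  ⊓ᶜ-greatest : ∀ {z a b} → z ≤ a → z ≤ b → z ≤ a ⊓ᶜ b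
  ⊓ᶜ-greatest p q = ⋀-greatest _ λ { (inj₁ refl) → p ; (inj₂ refl) → q }

  ⊔ᶜ-least : ∀ {z a b} → a ≤ z → b ≤ z → a ⊔ᶜ b ≤ z
  ⊔ᶜ-least p q = ⋁-least _ λ { (inj₁ refl) → p ; (inj₂ refl) → q }

  ⊓ᶜ-lowerʳ : ∀ {a b} → a ⊓ᶜ b ≤ b
  ⊓ᶜ-lowerʳ = ⋀-lower _ (inj₂ refl)

module CanonicalExtension {ℓ} (L : BoundedLattice ℓ ℓ ℓ) (D : CompleteLattice ℓ)
  (e : BoundedLattice.Carrier L → CompleteLattice.Carrier D)
  (ce : IsCanonicalExtension L D e) where
  private
    module L = BoundedLattice L
    module D = CompleteLattice D
  open CompleteLatticeFacts D
  open IsCanonicalExtension ce public using (e-cong)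
  open IsCanonicalExtension ce hiding (e-cong)

  Filter : D.Carrier → Set (Level.suc ℓ)
  Filter = IsFilterElt L D e

  Ideal : D.Carrier → Set (Level.suc ℓ)
  Ideal = IsIdealElt L D e

  e-mono : ∀ {a b} → a L.≤ b → e a D.≤ e b
  e-mono {a} {b} a≤b =
    trans (reflexive (e-cong (L.antisym (L.∧-greatest L.refl a≤b) (L.x∧y≤x a b))))
          (trans (reflexive (e-∧ a b)) ⊓ᶜ-lowerʳ)

  e-reflect : ∀ {a b} → e a D.≤ e b → a L.≤ b
  e-reflect {a} {b} ea≤eb = L.trans (L.reflexive a≈a∧b) (L.x∧y≤y a b)
    where
    a≈a∧b : a L.≈ (a L.∧ b)
    a≈a∧b = e-inj (antisym (trans (⊓ᶜ-greatest ≤-refl ea≤eb) (reflexive (Eq.sym (e-∧ a b))))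
                           (e-mono (L.x∧y≤x a b)))

  ≤-e⊤ : ∀ x → x D.≤ e L.⊤
  ≤-e⊤ x = trans (≤-⊤ᶜ x) (reflexive (Eq.sym e-⊤))

  e⊥-≤ : ∀ x → e L.⊥ D.≤ x
  e⊥-≤ x = trans (reflexive e-⊥) (⊥ᶜ-≤ x)

  ≤-e∧ : ∀ {z a b} → z D.≤ e a → z D.≤ e b → z D.≤ e (a L.∧ b)
  ≤-e∧ p q = trans (⊓ᶜ-greatest p q) (reflexive (Eq.sym (e-∧ _ _)))

  e∨-≤ : ∀ {z a b} → e a D.≤ z → e b D.≤ z → e (a L.∨ b) D.≤ z
  e∨-≤ p q = trans (reflexive (e-∨ _ _)) (⊔ᶜ-least p q)

  ↑ : D.Carrier → Pred L.Carrier ℓ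
  ↑ x a = x D.≤ e a

  ↓ : D.Carrier → Pred L.Carrier ℓ
  ↓ y a = e a D.≤ y

  ↑-directed : ∀ {x} → Directed L._≤_ (↑ x)
  ↑-directed = meet-closed-directed L (≤-e⊤ _) ≤-e∧

  ↓-directed : ∀ {y} → Directed (flip L._≤_) (↓ y)
  ↓-directed = join-closed-directed L (e⊥-≤ _) e∨-≤

  filter-≥-⋀↑ : ∀ {x} → Filter x → D.⋀ (img L D e (↑ x)) D.≤ x
  filter-≥-⋀↑ (S , x≈⋀S) =
    trans (D.⋀-greatest _ λ { (a , Sa , ea≈) →
             D.⋀-lower _ (a , trans (reflexive x≈⋀S) (D.⋀-lower _ (a , Sa , Eq.refl)) , ea≈) })
          (reflexive (Eq.sym x≈⋀S))

  ideal-≤-⋁↓ : ∀ {y} → Ideal y → y D.≤ D.⋁ (img L D e (↓ y))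
  ideal-≤-⋁↓ (T , y≈⋁T) =
    trans (reflexive y≈⋁T)
          (D.⋁-least _ λ { (a , Ta , ea≈) →
             D.⋁-upper _ (a , trans (D.⋁-upper _ (a , Ta , Eq.refl)) (reflexive (Eq.sym y≈⋁T)) , ea≈) })

  e-ideal : ∀ c → Ideal (e c)
  e-ideal c = (λ a → a ≡ c) ,
    antisym (D.⋁-upper _ (c , refl , Eq.refl))
            (D.⋁-least _ λ { (_ , refl , ea≈) → reflexive (Eq.sym ea≈) })

  compact-directed : (S T : Pred L.Carrier ℓ) → Directed L._≤_ S → Directed (flip L._≤_) T →
    D.⋀ (img L D e S) D.≤ D.⋁ (img L D e T) → ∃[ s ] ∃[ t ] (S s × T t × s L.≤ t)
  compact-directed S T S-dir T-dir ⋀S≤⋁T with compact S T ⋀S≤⋁T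
  ... | S′ , T′ , S′⊆S , T′⊆T , ⋀S′≤⋁T′
    with finite-bound L.trans S-dir S′⊆S | finite-bound (flip L.trans) T-dir T′⊆T
  ... | s , Ss , s≤S′ | t , Tt , T′≤t =
    s , t , Ss , Tt , e-reflect (trans es≤⋀S′ (trans ⋀S′≤⋁T′ ⋁T′≤et))
    where
    es≤⋀S′ : e s D.≤ D.⋀ (img L D e (listSet L D e S′))
    es≤⋀S′ = D.⋀-greatest _ λ { (a , a∈ , ea≈) → trans (e-mono (All.lookup s≤S′ a∈)) (reflexive ea≈) }
    ⋁T′≤et : D.⋁ (img L D e (listSet L D e T′)) D.≤ e t
    ⋁T′≤et = D.⋁-least _ λ { (a , a∈ , ea≈) → trans (reflexive (Eq.sym ea≈)) (e-mono (All.lookup T′≤t a∈)) }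

  filter-below-directed : ∀ {x T} → Filter x → Directed (flip L._≤_) T →
    x D.≤ D.⋁ (img L D e T) → ∃[ a ] ∃[ t ] (x D.≤ e a × T t × a L.≤ t)
  filter-below-directed {x} {T} fx T-dir x≤⋁T =
    compact-directed (↑ x) T ↑-directed T-dir (trans (filter-≥-⋀↑ fx) x≤⋁T)

  directed-below-ideal : ∀ {S y} → Directed L._≤_ S → Ideal y →
    D.⋀ (img L D e S) D.≤ y → ∃[ s ] ∃[ a ] (S s × e a D.≤ y × s L.≤ a)
  directed-below-ideal {S} {y} S-dir iy ⋀S≤y =
    compact-directed S (↓ y) S-dir ↓-directed (trans ⋀S≤y (ideal-≤-⋁↓ iy))

  interpolate : ∀ {x y} → Filter x → Ideal y → x D.≤ y → ∃[ a ] (x D.≤ e a × e a D.≤ y)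
  interpolate fx iy x≤y with filter-below-directed fx ↓-directed (trans x≤y (ideal-≤-⋁↓ iy))
  ... | a , b , x≤ea , eb≤y , a≤b = a , x≤ea , trans (e-mono a≤b) eb≤y

  ≤-by-ideals : ∀ {v w} → (∀ {z} → Ideal z → w D.≤ z → v D.≤ z) → v D.≤ w
  ≤-by-ideals {v} {w} below-ideals with dense-⋀∨ w
  ... | P , P-ideal , w≈⋀P =
    trans (D.⋀-greatest P λ Pz → below-ideals (P-ideal Pz) (trans (reflexive w≈⋀P) (D.⋀-lower P Pz)))
          (reflexive (Eq.sym w≈⋀P))

  ≥-by-filters : ∀ {v w} → (∀ {p} → Filter p → p D.≤ w → p D.≤ v) → w D.≤ v
  ≥-by-filters {v} {w} above-filters with dense-∨⋀ w
  ... | P , P-filter , w≈⋁P =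
    trans (reflexive w≈⋁P)
          (D.⋁-least P λ Pp → above-filters (P-filter Pp) (trans (D.⋁-upper P Pp) (reflexive (Eq.sym w≈⋁P))))

module LatticeHom {ℓ} (A B : BoundedLattice ℓ ℓ ℓ)
  (h : BoundedLattice.Carrier A → BoundedLattice.Carrier B) (hom : IsLatticeHom A B h) where
  private
    module A = BoundedLattice A
    module B = BoundedLattice B
  open IsLatticeHom hom

  h-mono : ∀ {a b} → a A.≤ b → h a B.≤ h b
  h-mono {a} {b} a≤b =
    B.trans (B.reflexive (cong (A.antisym (A.∧-greatest A.refl a≤b) (A.x∧y≤x a b))))
            (B.trans (B.reflexive (hom-∧ a b)) (B.x∧y≤y _ _))

  module _ (surj : Surjective A B h) where
    ⊤-≤-h⊤ : B.⊤ B.≤ h A.⊤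
    ⊤-≤-h⊤ with surj B.⊤
    ... | a , ha≈⊤ = B.trans (B.reflexive (B.Eq.sym ha≈⊤)) (h-mono (A.maximum a))

    h⊥-≤-⊥ : h A.⊥ B.≤ B.⊥
    h⊥-≤-⊥ with surj B.⊥
    ... | a , ha≈⊥ = B.trans (h-mono (A.minimum a)) (B.reflexive ha≈⊥)

module Extension {ℓ : Level} (A B : BoundedLattice ℓ ℓ ℓ) (Aδ Bδ : CompleteLattice ℓ)
  (eA : BoundedLattice.Carrier A → CompleteLattice.Carrier Aδ)
  (eB : BoundedLattice.Carrier B → CompleteLattice.Carrier Bδ)
  (h : BoundedLattice.Carrier A → BoundedLattice.Carrier B)
  (ceA : IsCanonicalExtension A Aδ eA) (ceB : IsCanonicalExtension B Bδ eB)
  (hom : IsLatticeHom A B h) (surj : Surjective A B h) where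
  private
    module A = BoundedLattice A
    module B = BoundedLattice B
    module Aδ = CompleteLattice Aδ
    module Bδ = CompleteLattice Bδ
    module ≤A = CompleteLatticeFacts Aδ
    module ≤B = CompleteLatticeFacts Bδ
    module CA = CanonicalExtension A Aδ eA ceA
    module CB = CanonicalExtension B Bδ eB ceB
    module Hom = IsLatticeHom hom
  open LatticeHom A B h hom

  H : Aδ.Carrier → Bδ.Carrier
  H = hδ A B Aδ Bδ eA eB h

  eBh-mono : ∀ {a b} → a A.≤ b → eB (h a) Bδ.≤ eB (h b)
  eBh-mono a≤b = CB.e-mono (h-mono a≤b)

  ≤-eBh∧ : ∀ {z a b} → z Bδ.≤ eB (h a) → z Bδ.≤ eB (h b) → z Bδ.≤ eB (h (a A.∧ b))
  ≤-eBh∧ p q = ≤B.trans (CB.≤-e∧ p q) (≤B.reflexive (CB.e-cong (B.Eq.sym (Hom.hom-∧ _ _))))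

  eBh∨-≤ : ∀ {z a b} → eB (h a) Bδ.≤ z → eB (h b) Bδ.≤ z → eB (h (a A.∨ b)) Bδ.≤ z
  eBh∨-≤ p q = ≤B.trans (≤B.reflexive (CB.e-cong (Hom.hom-∨ _ _))) (CB.e∨-≤ p q)

  hσ : Aδ.Carrier → Bδ.Carrier
  hσ x = Bδ.⋀ (img B Bδ eB (h [ CA.↑ x ]))

  hπ : Aδ.Carrier → Bδ.Carrier
  hπ y = Bδ.⋁ (img B Bδ eB (h [ CA.↓ y ]))

  hσ-filter : ∀ x → CB.Filter (hσ x)
  hσ-filter x = h [ CA.↑ x ] , ≤B.Eq.refl

  hπ-ideal : ∀ y → CB.Ideal (hπ y)
  hπ-ideal y = h [ CA.↓ y ] , ≤B.Eq.refl

  m : Aδ.Carrier → Aδ.Carrier → Bδ.Carrier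
  m x y = Bδ.⋀ (img B Bδ eB (λ b → ∃[ a ] (x Aδ.≤ eA a × eA a Aδ.≤ y × h a ≡ b)))

  hσ-≤-m : ∀ x y → hσ x Bδ.≤ m x y
  hσ-≤-m x y = Bδ.⋀-greatest _ λ { (b , (a , x≤a , _ , ha≡b) , eb≈) →
    Bδ.⋀-lower _ (b , (a , x≤a , ha≡b) , eb≈) }

  m-≤-H : ∀ {x y u} → CA.Filter x → CA.Ideal y → x Aδ.≤ u → u Aδ.≤ y → m x y Bδ.≤ H u
  m-≤-H fx iy x≤u u≤y = Bδ.⋁-upper _ (_ , _ , fx , iy , x≤u , u≤y , ≤B.Eq.refl)

  H-least : ∀ {u z} → (∀ {x y} → CA.Filter x → CA.Ideal y → x Aδ.≤ u → u Aδ.≤ y → m x y Bδ.≤ z) →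
    H u Bδ.≤ z
  H-least bound = Bδ.⋁-least _ λ { (x , y , fx , iy , x≤u , u≤y , v≈m) →
    ≤B.trans (≤B.reflexive v≈m) (bound fx iy x≤u u≤y) }

  m-≤-eBh : ∀ {x y a} → CA.Filter x → CA.Ideal y → x Aδ.≤ y → x Aδ.≤ eA a → m x y Bδ.≤ eB (h a)
  m-≤-eBh {x} {y} {a} fx iy x≤y x≤a with CA.interpolate fx iy x≤y
  ... | c , x≤c , c≤y =
    ≤B.trans (Bδ.⋀-lower _ (_ , (c A.∧ _ , CA.≤-e∧ x≤c x≤a , c∧a≤y , refl) , ≤B.Eq.refl))
             (eBh-mono (A.x∧y≤y _ _))
    where
    c∧a≤y : eA (c A.∧ a) Aδ.≤ y
    c∧a≤y = ≤A.trans (CA.e-mono (A.x∧y≤x _ _)) c≤y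

  hσ-≤-H : ∀ {x y u} → CA.Filter x → CA.Ideal y → x Aδ.≤ u → u Aδ.≤ y → hσ x Bδ.≤ H u
  hσ-≤-H fx iy x≤u u≤y = ≤B.trans (hσ-≤-m _ _) (m-≤-H fx iy x≤u u≤y)

  H-≤-hπ : ∀ {y u} → CA.Ideal y → u Aδ.≤ y → H u Bδ.≤ hπ y
  H-≤-hπ iy u≤y = H-least λ fx iy₀ x≤u u≤y₀ →
    let (a , x≤a , a≤y) = CA.interpolate fx iy (≤A.trans x≤u u≤y)
    in ≤B.trans (m-≤-eBh fx iy₀ (≤A.trans x≤u u≤y₀) x≤a)
                (Bδ.⋁-upper _ (h a , (a , a≤y , refl) , ≤B.Eq.refl))

  hσ-below-ideal : ∀ {x z} → CB.Ideal z → hσ x Bδ.≤ z → ∃[ a ] (x Aδ.≤ eA a × eB (h a) Bδ.≤ z)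
  hσ-below-ideal iz hσx≤z
    with CB.directed-below-ideal (image-directed h h-mono CA.↑-directed) iz hσx≤z
  ... | _ , b , (a , x≤a , refl) , eb≤z , ha≤b = a , x≤a , ≤B.trans (CB.e-mono ha≤b) eb≤z

  h⁻¹↓ : Bδ.Carrier → Pred A.Carrier ℓ
  h⁻¹↓ z a = eB (h a) Bδ.≤ z

  pullback : Bδ.Carrier → Aδ.Carrier
  pullback z = Aδ.⋁ (img A Aδ eA (h⁻¹↓ z))

  h⁻¹↓-directed : ∀ {z} → Directed (flip A._≤_) (h⁻¹↓ z)
  h⁻¹↓-directed = join-closed-directed A (≤B.trans (CB.e-mono (h⊥-≤-⊥ surj)) (CB.e⊥-≤ _)) eBh∨-≤

  ≤-pullback : ∀ {q z} → CB.Ideal z → hσ q Bδ.≤ z → q Aδ.≤ pullback z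
  ≤-pullback iz hσq≤z =
    let (a , q≤a , ha≤z) = hσ-below-ideal iz hσq≤z
    in ≤A.trans q≤a (Aδ.⋁-upper _ (a , ha≤z , ≤A.Eq.refl))

  H-≤-of-≤-pullback : ∀ {u z} → u Aδ.≤ pullback z → H u Bδ.≤ z
  H-≤-of-≤-pullback u≤pz = H-least λ fx iy x≤u u≤y →
    let (a , t , x≤a , ht≤z , a≤t) = CA.filter-below-directed fx h⁻¹↓-directed (≤A.trans x≤u u≤pz)
    in ≤B.trans (m-≤-eBh fx iy (≤A.trans x≤u u≤y) x≤a) (≤B.trans (eBh-mono a≤t) ht≤z)

  lift-set : Aδ.Carrier → Bδ.Carrier → Pred A.Carrier ℓ
  lift-set x p a = x Aδ.≤ eA a × p Bδ.≤ eB (h a)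

  lift : Aδ.Carrier → Bδ.Carrier → Aδ.Carrier
  lift x p = Aδ.⋀ (img A Aδ eA (lift-set x p))

  lift-filter : ∀ x p → CA.Filter (lift x p)
  lift-filter x p = lift-set x p , ≤A.Eq.refl

  lift-≤ : ∀ {x p a} → lift-set x p a → lift x p Aδ.≤ eA a
  lift-≤ s = Aδ.⋀-lower _ (_ , s , ≤A.Eq.refl)

  ≤-lift : ∀ {x p} → x Aδ.≤ lift x p
  ≤-lift = Aδ.⋀-greatest _ λ { (a , (x≤a , _) , ea≈) → ≤A.trans x≤a (≤A.reflexive ea≈) }

  lift-set-directed : ∀ {x p} → Directed A._≤_ (lift-set x p)
  lift-set-directed =
    meet-closed-directed A (CA.≤-e⊤ _ , ≤B.trans (CB.≤-e⊤ _) (CB.e-mono (⊤-≤-h⊤ surj)))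
      λ { (x≤a , p≤a) (x≤b , p≤b) → CA.≤-e∧ x≤a x≤b , ≤-eBh∧ p≤a p≤b }

  ≤-hσ-lift : ∀ {x p} → p Bδ.≤ hσ (lift x p)
  ≤-hσ-lift = Bδ.⋀-greatest _ λ { (_ , (c , lift≤c , refl) , ec≈) →
    let (s , a , (_ , p≤s) , ea≤ec , s≤a) =
          CA.directed-below-ideal lift-set-directed (CA.e-ideal c) lift≤c
    in ≤B.trans p≤s (≤B.trans (eBh-mono (A.trans s≤a (CA.e-reflect ea≤ec))) (≤B.reflexive ec≈)) }

  lift-≤-ideal : ∀ {x y p} → CA.Filter x → CA.Ideal y → x Aδ.≤ y →
    CB.Filter p → p Bδ.≤ hπ y → lift x p Aδ.≤ y
  lift-≤-ideal {x} {y} {p} fx iy x≤y fp p≤hπy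
    with CB.filter-below-directed fp (image-directed h h-mono CA.↓-directed) p≤hπy
       | CA.interpolate fx iy x≤y
  ... | b , _ , p≤b , (a , a≤y , refl) , b≤ha | c , x≤c , c≤y =
    ≤A.trans (lift-≤ (x≤c∨a , p≤c∨a)) (CA.e∨-≤ c≤y a≤y)
    where
    x≤c∨a : x Aδ.≤ eA (c A.∨ a)
    x≤c∨a = ≤A.trans x≤c (CA.e-mono (A.x≤x∨y _ _))
    p≤c∨a : p Bδ.≤ eB (h (c A.∨ a))
    p≤c∨a = ≤B.trans p≤b (≤B.trans (CB.e-mono b≤ha) (eBh-mono (A.y≤x∨y _ _)))

  -- Surjectivity realises an element of B between p and z as some h c.
  hσ-lift-≤-ideal : ∀ {x p z} → CB.Filter p → CB.Ideal z → hσ x Bδ.≤ z → p Bδ.≤ z →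
    hσ (lift x p) Bδ.≤ z
  hσ-lift-≤-ideal {x} {p} {z} fp iz hσx≤z p≤z
    with hσ-below-ideal iz hσx≤z | CB.interpolate fp iz p≤z
  ... | a , x≤a , ha≤z | b , p≤b , b≤z with surj b
  ... | c , hc≈b =
    ≤B.trans (Bδ.⋀-lower _ (_ , (a A.∨ c , lift-≤ (x≤a∨c , p≤a∨c) , refl) , ≤B.Eq.refl))
             (eBh∨-≤ ha≤z hc≤z)
    where
    hc≤z : eB (h c) Bδ.≤ z
    hc≤z = ≤B.trans (≤B.reflexive (CB.e-cong hc≈b)) b≤z
    x≤a∨c : x Aδ.≤ eA (a A.∨ c)
    x≤a∨c = ≤A.trans x≤a (CA.e-mono (A.x≤x∨y _ _))
    p≤a∨c : p Bδ.≤ eB (h (a A.∨ c))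
    p≤a∨c = ≤B.trans p≤b (≤B.trans (≤B.reflexive (CB.e-cong (B.Eq.sym hc≈b))) (eBh-mono (A.y≤x∨y _ _)))

  lift-point : ∀ {x y w} → CA.Filter x → CA.Ideal y → x Aδ.≤ y →
    hσ x Bδ.≤ w → w Bδ.≤ hπ y → ∃[ u ] (x Aδ.≤ u × u Aδ.≤ y × H u Bδ.≈ w)
  lift-point {x} {y} {w} fx iy x≤y hσx≤w w≤hπy = u , x≤u , u≤y , ≤B.antisym Hu≤w w≤Hu
    where
    Candidate : Pred Aδ.Carrier (Level.suc ℓ)
    Candidate q = CA.Filter q × x Aδ.≤ q × q Aδ.≤ y × hσ q Bδ.≤ w

    u : Aδ.Carrier
    u = Aδ.⋁ Candidate

    x≤u : x Aδ.≤ u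
    x≤u = Aδ.⋁-upper _ (fx , ≤A.≤-refl , x≤y , hσx≤w)

    u≤y : u Aδ.≤ y
    u≤y = Aδ.⋁-least _ λ { (_ , _ , q≤y , _) → q≤y }

    Hu≤w : H u Bδ.≤ w
    Hu≤w = CB.≤-by-ideals λ iz w≤z → H-≤-of-≤-pullback
      (Aδ.⋁-least _ λ { (_ , _ , _ , hσq≤w) → ≤-pullback iz (≤B.trans hσq≤w w≤z) })

    lift-candidate : ∀ {p} → CB.Filter p → p Bδ.≤ w → Candidate (lift x p)
    lift-candidate fp p≤w =
      lift-filter _ _ , ≤-lift , lift-≤-ideal fx iy x≤y fp (≤B.trans p≤w w≤hπy) ,
      CB.≤-by-ideals λ iz w≤z →
        hσ-lift-≤-ideal fp iz (≤B.trans hσx≤w w≤z) (≤B.trans p≤w w≤z)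

    w≤Hu : w Bδ.≤ H u
    w≤Hu = CB.≥-by-filters λ fp p≤w →
      let cand@(fq , _ , _ , _) = lift-candidate fp p≤w
      in ≤B.trans ≤-hσ-lift (hσ-≤-H fq iy (Aδ.⋁-upper _ cand) u≤y)

-- Around a point h^δ(u) with u in the basic interval
-- [x,y] ⊆ U, the basic interval [hσ x, hπ y] lies inside h^δ[U].
lemma1 : ∀ {ℓ : Level} (A B : BoundedLattice ℓ ℓ ℓ) (Aδ Bδ : CompleteLattice ℓ)
           (eA : BoundedLattice.Carrier A → CompleteLattice.Carrier Aδ)
           (eB : BoundedLattice.Carrier B → CompleteLattice.Carrier Bδ)
           (h : BoundedLattice.Carrier A → BoundedLattice.Carrier B) →
           IsCanonicalExtension A Aδ eA → IsCanonicalExtension B Bδ eB →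
           IsLatticeHom A B h → Surjective A B h →
           (U : Pred (CompleteLattice.Carrier Aδ) ℓ) → IsδOpen A Aδ eA U →
           IsδOpen B Bδ eB (image Aδ Bδ (hδ A B Aδ Bδ eA eB h) U)
lemma1 A B Aδ Bδ eA eB h ceA ceB hom surj U U-open v (u , Uu , Hu≈v)
  with U-open u Uu
... | x , y , fx , iy , x≤u , u≤y , [x,y]⊆U =
  hσ x , hπ y , hσ-filter x , hπ-ideal y ,
  ≤B.trans (hσ-≤-H fx iy x≤u u≤y) (≤B.reflexive Hu≈v) ,
  ≤B.trans (≤B.reflexive (≤B.Eq.sym Hu≈v)) (H-≤-hπ iy u≤y) ,
  λ w hσx≤w w≤hπy →
    let (u′ , x≤u′ , u′≤y , Hu′≈w) = lift-point fx iy (≤A.trans x≤u u≤y) hσx≤w w≤hπy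
    in u′ , [x,y]⊆U u′ x≤u′ u′≤y , Hu′≈w
  where
  open Extension A B Aδ Bδ eA eB h ceA ceB hom surj
  module ≤A = CompleteLatticeFacts Aδ
  module ≤B = CompleteLatticeFacts Bδ
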